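{- In a model of linear dependent type theory with unit that supports $\multimap$ type formers, any fibred adjunction $L \dashv M$ between $\mathcal{L}$ and $\mathcal{T}$ (with $L:\mathcal{T}\to\mathcal{L}$, $M:\mathcal{L}\to\mathcal{T}$ cartesian functors over $\mathcal{C}$) such that $L(1)\cong I$ satisfies, for all $\Gamma\in\mathcal{C}$, $A\in\mathcal{T}_\Gamma$ and $\Xi', B\in\mathcal{L}_\Gamma$, \[\mathcal{L}_{\Gamma.A}(\pi_A^*(\Xi'), \pi_A^*(B)) \cong \mathcal{L}_\Gamma(LA\otimes\Xi', B).\]
   Context: A model of linear dependent type theory consists of a category $\mathcal{C}$ with terminal object, a full split comprehension category $\pi:\mathcal{T}\to\mathcal{C}^{\to}$ (with fibers $\mathcal{T}_\Gamma$ of the split fibration $\mathrm{cod}\circ\pi$; for $A\in\mathcal{T}_\Gamma$, $\pi(A) = \pi_A:\Gamma.A\to\Gamma$), and a split symmetric monoidal fibration $q:\mathcal{L}\to\mathcal{C}$, i.e. a split fibration whose fibers $\mathcal{L}_\Gamma$ are symmetric monoidal categories (tensor $\otimes$, unit $I$) and whose reindexing functors $f^*$ are strict monoidal. "With unit" means each $\mathcal{T}_\Gamma$ has a terminal object $1$ preserved by reindexing. The model supports $\multimap$ if each fiber $\mathcal{L}_\Gamma$ is monoidal closed, with internal hom $[-,-]$, and reindexing functors preserve internal homs up to isomorphism. A fibred adjunction $L\dashv M$ is a pair of cartesian functors over $\mathcal{C}$ with fiberwise adjunctions $L_\Gamma\dashv M_\Gamma$ commuting with reindexing up to coherent natural isomorphism.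 -}

module Defs where

open import Level using (Level; _⊔_; suc)
open import Relation.Binary.PropositionalEquality
  using (_≡_; refl; subst; subst₂; sym; trans; cong)
open import Data.Product using (Σ; _,_; _×_)
open import Function.Bundles using (_↔_)

record Category (o ℓ : Level) : Set (suc (o ⊔ ℓ)) where
  infixr 9 _∘_
  infix 4 _⇒_
  field
    Obj : Set o
    _⇒_ : Obj → Obj → Set ℓ
    id  : ∀ {A} → A ⇒ A
    _∘_ : ∀ {A B C} → B ⇒ C → A ⇒ B → A ⇒ C
    assoc : ∀ {A B C D} {f : A ⇒ B} {g : B ⇒ C} {h : C ⇒ D} →
            (h ∘ g) ∘ f ≡ h ∘ (g ∘ f)
    identityˡ : ∀ {A B} {f : A ⇒ B} → id ∘ f ≡ f
    identityʳ : ∀ {A B} {f : A ⇒ B} → f ∘ id ≡ f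

module _ {o ℓ} (C : Category o ℓ) where
  open Category C

  record Iso (A B : Obj) : Set ℓ where
    field
      from : A ⇒ B
      to   : B ⇒ A
      isoˡ : to ∘ from ≡ id
      isoʳ : from ∘ to ≡ id

  record IsIso {A B : Obj} (f : A ⇒ B) : Set ℓ where
    field
      inv  : B ⇒ A
      isoˡ : inv ∘ f ≡ id
      isoʳ : f ∘ inv ≡ id

  record IsTerminal (T : Obj) : Set (o ⊔ ℓ) where
    field
      !        : ∀ {A} → A ⇒ T
      !-unique : ∀ {A} (f : A ⇒ T) → f ≡ !

  record IsPullback {X Y Z P : Obj} (f : X ⇒ Z) (g : Y ⇒ Z)
                    (p₁ : P ⇒ X) (p₂ : P ⇒ Y) : Set (o ⊔ ℓ) where
    field
      commute   : f ∘ p₁ ≡ g ∘ p₂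
      universal : ∀ {Q} (h₁ : Q ⇒ X) (h₂ : Q ⇒ Y) → f ∘ h₁ ≡ g ∘ h₂ → Q ⇒ P
      p₁∘universal : ∀ {Q} {h₁ : Q ⇒ X} {h₂ : Q ⇒ Y} (eq : f ∘ h₁ ≡ g ∘ h₂) →
                     p₁ ∘ universal h₁ h₂ eq ≡ h₁
      p₂∘universal : ∀ {Q} {h₁ : Q ⇒ X} {h₂ : Q ⇒ Y} (eq : f ∘ h₁ ≡ g ∘ h₂) →
                     p₂ ∘ universal h₁ h₂ eq ≡ h₂
      unique : ∀ {Q} {h₁ : Q ⇒ X} {h₂ : Q ⇒ Y} (eq : f ∘ h₁ ≡ g ∘ h₂) (u : Q ⇒ P) →
               p₁ ∘ u ≡ h₁ → p₂ ∘ u ≡ h₂ → u ≡ universal h₁ h₂ eq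

record Functor {o ℓ o' ℓ'} (C : Category o ℓ) (D : Category o' ℓ')
       : Set (o ⊔ ℓ ⊔ o' ⊔ ℓ') where
  private
    module C = Category C
    module D = Category D
  field
    F₀ : C.Obj → D.Obj
    F₁ : ∀ {A B} → A C.⇒ B → F₀ A D.⇒ F₀ B
    identity : ∀ {A} → F₁ (C.id {A}) ≡ D.id
    homomorphism : ∀ {A B E} {f : A C.⇒ B} {g : B C.⇒ E} →
                   F₁ (g C.∘ f) ≡ F₁ g D.∘ F₁ f

_∘F_ : ∀ {o₁ ℓ₁ o₂ ℓ₂ o₃ ℓ₃} {C : Category o₁ ℓ₁} {D : Category o₂ ℓ₂}
         {E : Category o₃ ℓ₃} → Functor D E → Functor C D → Functor C E
_∘F_ {E = E} G F = record
  { F₀ = λ X → G.F₀ (F.F₀ X)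
  ; F₁ = λ f → G.F₁ (F.F₁ f)
  ; identity = trans (cong G.F₁ F.identity) G.identity
  ; homomorphism = trans (cong G.F₁ F.homomorphism) G.homomorphism
  }
  where
    module F = Functor F
    module G = Functor G

record NatIso {o ℓ o' ℓ'} {C : Category o ℓ} {D : Category o' ℓ'}
              (F G : Functor C D) : Set (o ⊔ ℓ ⊔ ℓ') where
  private
    module C = Category C
    module D = Category D
    module F = Functor F
    module G = Functor G
  field
    η : ∀ X → Iso D (F.F₀ X) (G.F₀ X)
    natural : ∀ {X Y} (f : X C.⇒ Y) →
              Iso.from (η Y) D.∘ F.F₁ f ≡ G.F₁ f D.∘ Iso.from (η X)

-- Split fibrations over C, in their (equivalent) presentation as strict
-- functors C^op → Cat: fibres Fib Γ and strictly functorial reindexing f^*.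

record SplitIndexedCategory {o ℓ} (C : Category o ℓ) (o' ℓ' : Level)
       : Set (o ⊔ ℓ ⊔ suc (o' ⊔ ℓ')) where
  open Category C
  field
    Fib     : Obj → Category o' ℓ'
    reindex : ∀ {Δ Γ} → Δ ⇒ Γ → Functor (Fib Γ) (Fib Δ)
    id-obj  : ∀ {Γ} (A : Category.Obj (Fib Γ)) →
              Functor.F₀ (reindex (id {Γ})) A ≡ A
    id-hom  : ∀ {Γ} {A B : Category.Obj (Fib Γ)} (h : Category._⇒_ (Fib Γ) A B) →
              subst₂ (Category._⇒_ (Fib Γ)) (id-obj A) (id-obj B)
                     (Functor.F₁ (reindex (id {Γ})) h) ≡ h
    comp-obj : ∀ {Θ Δ Γ} (f : Θ ⇒ Δ) (g : Δ ⇒ Γ) (A : Category.Obj (Fib Γ)) →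
               Functor.F₀ (reindex (g ∘ f)) A ≡
               Functor.F₀ (reindex f) (Functor.F₀ (reindex g) A)
    comp-hom : ∀ {Θ Δ Γ} (f : Θ ⇒ Δ) (g : Δ ⇒ Γ)
                 {A B : Category.Obj (Fib Γ)} (h : Category._⇒_ (Fib Γ) A B) →
               subst₂ (Category._⇒_ (Fib Θ)) (comp-obj f g A) (comp-obj f g B)
                      (Functor.F₁ (reindex (g ∘ f)) h) ≡
               Functor.F₁ (reindex f) (Functor.F₁ (reindex g) h)

module IxN {o ℓ o' ℓ'} {C : Category o ℓ} (T : SplitIndexedCategory C o' ℓ') where
  open Category C
  open SplitIndexedCategory T

  Ob : Obj → Set o'
  Ob Γ = Category.Obj (Fib Γ)

  Hom : (Γ : Obj) → Ob Γ → Ob Γ → Set ℓ'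
  Hom Γ = Category._⇒_ (Fib Γ)

  idv : ∀ {Γ} {A : Ob Γ} → Hom Γ A A
  idv {Γ} = Category.id (Fib Γ)

  infixr 9 _∘v_
  _∘v_ : ∀ {Γ} {A B D : Ob Γ} → Hom Γ B D → Hom Γ A B → Hom Γ A D
  _∘v_ {Γ} = Category._∘_ (Fib Γ)

  infixr 20 _^*₀_ _^*₁_
  _^*₀_ : ∀ {Δ Γ} → Δ ⇒ Γ → Ob Γ → Ob Δ
  f ^*₀ A = Functor.F₀ (reindex f) A

  _^*₁_ : ∀ {Δ Γ} (f : Δ ⇒ Γ) {A B : Ob Γ} → Hom Γ A B → Hom Δ (f ^*₀ A) (f ^*₀ B)
  f ^*₁ h = Functor.F₁ (reindex f) h

-- Full split comprehension category π : T → C^→ (indexed presentation)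

record FullSplitComprehension {o ℓ o' ℓ'} (C : Category o ℓ)
       (T : SplitIndexedCategory C o' ℓ') : Set (o ⊔ ℓ ⊔ o' ⊔ ℓ') where
  open Category C
  open SplitIndexedCategory T
  open IxN T
  infixl 5 _·_
  field
    _·_ : (Γ : Obj) → Ob Γ → Obj
    π   : ∀ {Γ} (A : Ob Γ) → Γ · A ⇒ Γ
    ⟪_⟫ : ∀ {Γ} {A B : Ob Γ} → Hom Γ A B → Γ · A ⇒ Γ · B
    ⟪⟫-over : ∀ {Γ} {A B : Ob Γ} (h : Hom Γ A B) → π B ∘ ⟪ h ⟫ ≡ π A
    ⟪⟫-identity : ∀ {Γ} {A : Ob Γ} → ⟪ idv {Γ} {A} ⟫ ≡ id
    ⟪⟫-homomorphism : ∀ {Γ} {A B D : Ob Γ} (h : Hom Γ A B) (k : Hom Γ B D) →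
                      ⟪ k ∘v h ⟫ ≡ ⟪ k ⟫ ∘ ⟪ h ⟫
    -- action on the chosen cartesian maps f^*A → A
    q : ∀ {Δ Γ} (f : Δ ⇒ Γ) (A : Ob Γ) → Δ · (f ^*₀ A) ⇒ Γ · A
    q-pullback : ∀ {Δ Γ} (f : Δ ⇒ Γ) (A : Ob Γ) →
                 IsPullback C (π A) f (q f A) (π (f ^*₀ A))
    q-natural : ∀ {Δ Γ} (f : Δ ⇒ Γ) {A B : Ob Γ} (h : Hom Γ A B) →
                q f B ∘ ⟪ f ^*₁ h ⟫ ≡ ⟪ h ⟫ ∘ q f A
    q-identity : ∀ {Γ} (A : Ob Γ) →
                 subst (λ X → Γ · X ⇒ Γ · A) (id-obj A) (q (id {Γ}) A) ≡ id
    q-homomorphism : ∀ {Θ Δ Γ} (f : Θ ⇒ Δ) (g : Δ ⇒ Γ) (A : Ob Γ) →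
                     subst (λ X → Θ · X ⇒ Γ · A) (comp-obj f g A) (q (g ∘ f) A)
                       ≡ q g A ∘ q f (g ^*₀ A)
    -- fullness and faithfulness of π: maps A → B in T over f : Δ → Γ
    -- (i.e. vertical h : A → f^*B) correspond to maps Δ.A → Γ.B over f
    full : ∀ {Δ Γ} (f : Δ ⇒ Γ) {A : Ob Δ} {B : Ob Γ} (k : Δ · A ⇒ Γ · B) →
           π B ∘ k ≡ f ∘ π A →
           Σ (Hom Δ A (f ^*₀ B)) (λ h → q f B ∘ ⟪ h ⟫ ≡ k)
    faithful : ∀ {Δ Γ} (f : Δ ⇒ Γ) {A : Ob Δ} {B : Ob Γ}
                 (h h' : Hom Δ A (f ^*₀ B)) →
               q f B ∘ ⟪ h ⟫ ≡ q f B ∘ ⟪ h' ⟫ → h ≡ h'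

-- "with unit": terminal objects in each fibre, preserved by reindexing
record HasUnit {o ℓ o' ℓ'} {C : Category o ℓ}
       (T : SplitIndexedCategory C o' ℓ') : Set (o ⊔ ℓ ⊔ o' ⊔ ℓ') where
  open Category C
  open SplitIndexedCategory T
  open IxN T
  field
    one : ∀ Γ → Ob Γ
    one-terminal : ∀ Γ → IsTerminal (Fib Γ) (one Γ)
    one-preserved : ∀ {Δ Γ} (f : Δ ⇒ Γ) → IsTerminal (Fib Δ) (f ^*₀ one Γ)

record SymmetricMonoidal {o ℓ} (C : Category o ℓ) : Set (o ⊔ ℓ) where
  open Category C
  infixr 10 _⊗₀_ _⊗₁_
  field
    _⊗₀_ : Obj → Obj → Obj
    _⊗₁_ : ∀ {X Y Z W} → X ⇒ Y → Z ⇒ W → X ⊗₀ Z ⇒ Y ⊗₀ W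
    ⊗-identity : ∀ {X Y} → id {X} ⊗₁ id {Y} ≡ id
    ⊗-homomorphism : ∀ {X₁ Y₁ Z₁ X₂ Y₂ Z₂} {f : X₁ ⇒ Y₁} {g : Y₁ ⇒ Z₁}
                       {h : X₂ ⇒ Y₂} {k : Y₂ ⇒ Z₂} →
                     (g ∘ f) ⊗₁ (k ∘ h) ≡ (g ⊗₁ k) ∘ (f ⊗₁ h)
    unit : Obj
    associator : ∀ X Y Z → Iso C ((X ⊗₀ Y) ⊗₀ Z) (X ⊗₀ (Y ⊗₀ Z))
    unitorˡ : ∀ X → Iso C (unit ⊗₀ X) X
    unitorʳ : ∀ X → Iso C (X ⊗₀ unit) X
    braiding : ∀ X Y → Iso C (X ⊗₀ Y) (Y ⊗₀ X)
    assoc-natural : ∀ {X X' Y Y' Z Z'} (f : X ⇒ X') (g : Y ⇒ Y') (h : Z ⇒ Z') →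
      Iso.from (associator X' Y' Z') ∘ ((f ⊗₁ g) ⊗₁ h)
        ≡ (f ⊗₁ (g ⊗₁ h)) ∘ Iso.from (associator X Y Z)
    unitorˡ-natural : ∀ {X Y} (f : X ⇒ Y) →
      Iso.from (unitorˡ Y) ∘ (id ⊗₁ f) ≡ f ∘ Iso.from (unitorˡ X)
    unitorʳ-natural : ∀ {X Y} (f : X ⇒ Y) →
      Iso.from (unitorʳ Y) ∘ (f ⊗₁ id) ≡ f ∘ Iso.from (unitorʳ X)
    braiding-natural : ∀ {X X' Y Y'} (f : X ⇒ X') (g : Y ⇒ Y') →
      Iso.from (braiding X' Y') ∘ (f ⊗₁ g) ≡ (g ⊗₁ f) ∘ Iso.from (braiding X Y)
    triangle : ∀ X Y →
      (id {X} ⊗₁ Iso.from (unitorˡ Y)) ∘ Iso.from (associator X unit Y)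
        ≡ Iso.from (unitorʳ X) ⊗₁ id {Y}
    pentagon : ∀ X Y Z W →
      (id {X} ⊗₁ Iso.from (associator Y Z W)) ∘
        (Iso.from (associator X (Y ⊗₀ Z) W) ∘ (Iso.from (associator X Y Z) ⊗₁ id {W}))
        ≡ Iso.from (associator X Y (Z ⊗₀ W)) ∘ Iso.from (associator (X ⊗₀ Y) Z W)
    hexagon : ∀ X Y Z →
      Iso.from (associator Y Z X) ∘
        (Iso.from (braiding X (Y ⊗₀ Z)) ∘ Iso.from (associator X Y Z))
        ≡ (id {Y} ⊗₁ Iso.from (braiding X Z)) ∘
            (Iso.from (associator Y X Z) ∘ (Iso.from (braiding X Y) ⊗₁ id {Z}))
    symmetry : ∀ X Y → Iso.from (braiding Y X) ∘ Iso.from (braiding X Y) ≡ id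

-- monoidal closedness: - ⊗ Y ⊣ [ Y , - ], via the universal property of evaluation
record Closed {o ℓ} {C : Category o ℓ} (M : SymmetricMonoidal C) : Set (o ⊔ ℓ) where
  open Category C
  open SymmetricMonoidal M
  field
    [_,_] : Obj → Obj → Obj
    eval  : ∀ {Y Z} → [ Y , Z ] ⊗₀ Y ⇒ Z
    curry : ∀ {X Y Z} → X ⊗₀ Y ⇒ Z → X ⇒ [ Y , Z ]
    eval-curry : ∀ {X Y Z} (h : X ⊗₀ Y ⇒ Z) → eval ∘ (curry h ⊗₁ id) ≡ h
    curry-unique : ∀ {X Y Z} (h : X ⊗₀ Y ⇒ Z) (g : X ⇒ [ Y , Z ]) →
                   eval ∘ (g ⊗₁ id) ≡ h → g ≡ curry h

module MonN {o ℓ o' ℓ'} {C : Category o ℓ} (L : SplitIndexedCategory C o' ℓ')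
            (mon : ∀ Γ → SymmetricMonoidal (SplitIndexedCategory.Fib L Γ)) where
  open Category C
  open IxN L

  infixr 10 _⊗_ _⊗h_
  _⊗_ : ∀ {Γ} → Ob Γ → Ob Γ → Ob Γ
  _⊗_ {Γ} = SymmetricMonoidal._⊗₀_ (mon Γ)

  _⊗h_ : ∀ {Γ} {X Y Z W : Ob Γ} → Hom Γ X Y → Hom Γ Z W → Hom Γ (X ⊗ Z) (Y ⊗ W)
  _⊗h_ {Γ} = SymmetricMonoidal._⊗₁_ (mon Γ)

  I : ∀ Γ → Ob Γ
  I Γ = SymmetricMonoidal.unit (mon Γ)

  αf : ∀ {Γ} (X Y Z : Ob Γ) → Hom Γ ((X ⊗ Y) ⊗ Z) (X ⊗ (Y ⊗ Z))
  αf {Γ} X Y Z = Iso.from (SymmetricMonoidal.associator (mon Γ) X Y Z)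

  λf : ∀ {Γ} (X : Ob Γ) → Hom Γ (I Γ ⊗ X) X
  λf {Γ} X = Iso.from (SymmetricMonoidal.unitorˡ (mon Γ) X)

  ρf : ∀ {Γ} (X : Ob Γ) → Hom Γ (X ⊗ I Γ) X
  ρf {Γ} X = Iso.from (SymmetricMonoidal.unitorʳ (mon Γ) X)

record StrictMonoidalReindexing {o ℓ o' ℓ'} {C : Category o ℓ}
       (L : SplitIndexedCategory C o' ℓ')
       (mon : ∀ Γ → SymmetricMonoidal (SplitIndexedCategory.Fib L Γ))
       : Set (o ⊔ ℓ ⊔ o' ⊔ ℓ') where
  open Category C
  open IxN L
  open MonN L mon
  field
    ⊗-obj : ∀ {Δ Γ} (f : Δ ⇒ Γ) (X Y : Ob Γ) → f ^*₀ (X ⊗ Y) ≡ (f ^*₀ X) ⊗ (f ^*₀ Y)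
    I-obj : ∀ {Δ Γ} (f : Δ ⇒ Γ) → f ^*₀ I Γ ≡ I Δ
    ⊗-hom : ∀ {Δ Γ} (f : Δ ⇒ Γ) {X Y Z W : Ob Γ} (h : Hom Γ X Y) (k : Hom Γ Z W) →
            subst₂ (Hom Δ) (⊗-obj f X Z) (⊗-obj f Y W) (f ^*₁ (h ⊗h k))
              ≡ (f ^*₁ h) ⊗h (f ^*₁ k)
    α-pres : ∀ {Δ Γ} (f : Δ ⇒ Γ) (X Y Z : Ob Γ) →
             subst₂ (Hom Δ)
               (trans (⊗-obj f (X ⊗ Y) Z) (cong (λ V → V ⊗ (f ^*₀ Z)) (⊗-obj f X Y)))
               (trans (⊗-obj f X (Y ⊗ Z)) (cong (λ V → (f ^*₀ X) ⊗ V) (⊗-obj f Y Z)))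
               (f ^*₁ αf X Y Z)
             ≡ αf (f ^*₀ X) (f ^*₀ Y) (f ^*₀ Z)
    λ-pres : ∀ {Δ Γ} (f : Δ ⇒ Γ) (X : Ob Γ) →
             subst₂ (Hom Δ)
               (trans (⊗-obj f (I Γ) X) (cong (λ V → V ⊗ (f ^*₀ X)) (I-obj f)))
               refl
               (f ^*₁ λf X)
             ≡ λf (f ^*₀ X)
    ρ-pres : ∀ {Δ Γ} (f : Δ ⇒ Γ) (X : Ob Γ) →
             subst₂ (Hom Δ)
               (trans (⊗-obj f X (I Γ)) (cong (λ V → (f ^*₀ X) ⊗ V) (I-obj f)))
               refl
               (f ^*₁ ρf X)
             ≡ ρf (f ^*₀ X)

record SplitSymmetricMonoidalFibration {o ℓ} (C : Category o ℓ) (o' ℓ' : Level)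
       : Set (o ⊔ ℓ ⊔ suc (o' ⊔ ℓ')) where
  field
    L        : SplitIndexedCategory C o' ℓ'
    monoidal : ∀ Γ → SymmetricMonoidal (SplitIndexedCategory.Fib L Γ)
    strict   : StrictMonoidalReindexing L monoidal

module _ {o ℓ o' ℓ'} {C : Category o ℓ} (𝓛 : SplitSymmetricMonoidalFibration C o' ℓ')
         (closed : ∀ Γ → Closed (SplitSymmetricMonoidalFibration.monoidal 𝓛 Γ)) where
  open Category C
  open SplitSymmetricMonoidalFibration 𝓛
  open IxN L
  open MonN L monoidal
  open StrictMonoidalReindexing strict

  homComparison : ∀ {Δ Γ} (f : Δ ⇒ Γ) (X Y : Ob Γ) →
    Hom Δ (f ^*₀ Closed.[_,_] (closed Γ) X Y)
          (Closed.[_,_] (closed Δ) (f ^*₀ X) (f ^*₀ Y))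
  homComparison {Δ} {Γ} f X Y =
    Closed.curry (closed Δ)
      (subst (λ V → Hom Δ V (f ^*₀ Y))
             (⊗-obj f (Closed.[_,_] (closed Γ) X Y) X)
             (f ^*₁ Closed.eval (closed Γ)))

-- supports ⊸: fibres monoidal closed, reindexing preserves internal homs
record SupportsLolli {o ℓ o' ℓ'} {C : Category o ℓ}
       (𝓛 : SplitSymmetricMonoidalFibration C o' ℓ') : Set (o ⊔ ℓ ⊔ o' ⊔ ℓ') where
  open Category C
  open SplitSymmetricMonoidalFibration 𝓛
  field
    closed : ∀ Γ → Closed (monoidal Γ)
    preserves-hom : ∀ {Δ Γ} (f : Δ ⇒ Γ) (X Y : IxN.Ob L Γ) →
                    IsIso (SplitIndexedCategory.Fib L Δ) (homComparison 𝓛 closed f X Y)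

-- Cartesian functors between split fibrations (indexed presentation:
-- pseudo-natural transformations) and fibred adjunctions

record CartesianFunctor {o ℓ o₁ ℓ₁ o₂ ℓ₂} {C : Category o ℓ}
       (T : SplitIndexedCategory C o₁ ℓ₁) (S : SplitIndexedCategory C o₂ ℓ₂)
       : Set (o ⊔ ℓ ⊔ o₁ ⊔ ℓ₁ ⊔ o₂ ⊔ ℓ₂) where
  open Category C
  module T = SplitIndexedCategory T
  module S = SplitIndexedCategory S
  module TN = IxN T
  module SN = IxN S
  field
    F : ∀ Γ → Functor (T.Fib Γ) (S.Fib Γ)
    φ : ∀ {Δ Γ} (f : Δ ⇒ Γ) → NatIso (S.reindex f ∘F F Γ) (F Δ ∘F T.reindex f)
    φ-identity : ∀ {Γ} (A : TN.Ob Γ) →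
      subst₂ (SN.Hom Γ) (S.id-obj (Functor.F₀ (F Γ) A))
                        (cong (Functor.F₀ (F Γ)) (T.id-obj A))
             (Iso.from (NatIso.η (φ (id {Γ})) A))
        ≡ SN.idv
    φ-homomorphism : ∀ {Θ Δ Γ} (f : Θ ⇒ Δ) (g : Δ ⇒ Γ) (A : TN.Ob Γ) →
      subst₂ (SN.Hom Θ) (S.comp-obj f g (Functor.F₀ (F Γ) A))
                        (cong (Functor.F₀ (F Θ)) (T.comp-obj f g A))
             (Iso.from (NatIso.η (φ (g ∘ f)) A))
        ≡ Iso.from (NatIso.η (φ f) (g TN.^*₀ A))
            SN.∘v (f SN.^*₁ Iso.from (NatIso.η (φ g) A))

record FibredAdjunction {o ℓ o₁ ℓ₁ o₂ ℓ₂} {C : Category o ℓ}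
       {T : SplitIndexedCategory C o₁ ℓ₁} {S : SplitIndexedCategory C o₂ ℓ₂}
       (Lf : CartesianFunctor T S) (Mf : CartesianFunctor S T)
       : Set (o ⊔ ℓ ⊔ o₁ ⊔ ℓ₁ ⊔ o₂ ⊔ ℓ₂) where
  open Category C
  module TN = IxN T
  module SN = IxN S
  private
    L₀ : ∀ {Γ} → TN.Ob Γ → SN.Ob Γ
    L₀ {Γ} = Functor.F₀ (CartesianFunctor.F Lf Γ)
    L₁ : ∀ {Γ} {A B : TN.Ob Γ} → TN.Hom Γ A B → SN.Hom Γ (L₀ A) (L₀ B)
    L₁ {Γ} = Functor.F₁ (CartesianFunctor.F Lf Γ)
    M₀ : ∀ {Γ} → SN.Ob Γ → TN.Ob Γ
    M₀ {Γ} = Functor.F₀ (CartesianFunctor.F Mf Γ)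
    M₁ : ∀ {Γ} {X Y : SN.Ob Γ} → SN.Hom Γ X Y → TN.Hom Γ (M₀ X) (M₀ Y)
    M₁ {Γ} = Functor.F₁ (CartesianFunctor.F Mf Γ)
    φL : ∀ {Δ Γ} (f : Δ ⇒ Γ) (A : TN.Ob Γ) → SN.Hom Δ (f SN.^*₀ L₀ A) (L₀ (f TN.^*₀ A))
    φL f A = Iso.from (NatIso.η (CartesianFunctor.φ Lf f) A)
    φM : ∀ {Δ Γ} (f : Δ ⇒ Γ) (X : SN.Ob Γ) → TN.Hom Δ (f TN.^*₀ M₀ X) (M₀ (f SN.^*₀ X))
    φM f X = Iso.from (NatIso.η (CartesianFunctor.φ Mf f) X)
  field
    unit   : ∀ {Γ} (A : TN.Ob Γ) → TN.Hom Γ A (M₀ (L₀ A))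
    counit : ∀ {Γ} (X : SN.Ob Γ) → SN.Hom Γ (L₀ (M₀ X)) X
    unit-natural : ∀ {Γ} {A B : TN.Ob Γ} (h : TN.Hom Γ A B) →
                   unit B TN.∘v h ≡ M₁ (L₁ h) TN.∘v unit A
    counit-natural : ∀ {Γ} {X Y : SN.Ob Γ} (h : SN.Hom Γ X Y) →
                     counit Y SN.∘v L₁ (M₁ h) ≡ h SN.∘v counit X
    zig : ∀ {Γ} (A : TN.Ob Γ) → counit (L₀ A) SN.∘v L₁ (unit A) ≡ SN.idv
    zag : ∀ {Γ} (X : SN.Ob Γ) → M₁ (counit X) TN.∘v unit (M₀ X) ≡ TN.idv
    unit-reindex : ∀ {Δ Γ} (f : Δ ⇒ Γ) (A : TN.Ob Γ) →
      M₁ (φL f A) TN.∘v (φM f (L₀ A) TN.∘v (f TN.^*₁ unit A)) ≡ unit (f TN.^*₀ A)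
    counit-reindex : ∀ {Δ Γ} (f : Δ ⇒ Γ) (X : SN.Ob Γ) →
      counit (f SN.^*₀ X) SN.∘v (L₁ (φM f X) SN.∘v φL f (M₀ X)) ≡ f SN.^*₁ counit X

record LDTTModel (o ℓ o₁ ℓ₁ o₂ ℓ₂ : Level)
       : Set (suc (o ⊔ ℓ ⊔ o₁ ⊔ ℓ₁ ⊔ o₂ ⊔ ℓ₂)) where
  field
    𝓒         : Category o ℓ
    ⊤          : Category.Obj 𝓒
    ⊤-terminal : IsTerminal 𝓒 ⊤
    𝓣         : SplitIndexedCategory 𝓒 o₁ ℓ₁
    comp       : FullSplitComprehension 𝓒 𝓣
    𝓛mon      : SplitSymmetricMonoidalFibration 𝓒 o₂ ℓ₂
  𝓛 : SplitIndexedCategory 𝓒 o₂ ℓ₂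
  𝓛 = SplitSymmetricMonoidalFibration.L 𝓛mon

record WithUnit {o ℓ o₁ ℓ₁ o₂ ℓ₂} (𝓜 : LDTTModel o ℓ o₁ ℓ₁ o₂ ℓ₂)
       : Set (o ⊔ ℓ ⊔ o₁ ⊔ ℓ₁) where
  field
    hasUnit : HasUnit (LDTTModel.𝓣 𝓜)

SupportsLolliModel : ∀ {o ℓ o₁ ℓ₁ o₂ ℓ₂} → LDTTModel o ℓ o₁ ℓ₁ o₂ ℓ₂ → Set (o ⊔ ℓ ⊔ o₂ ⊔ ℓ₂)
SupportsLolliModel 𝓜 = SupportsLolli (LDTTModel.𝓛mon 𝓜)

module ModelN {o ℓ o₁ ℓ₁ o₂ ℓ₂} (𝓜 : LDTTModel o ℓ o₁ ℓ₁ o₂ ℓ₂) where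
  open LDTTModel 𝓜 public
  open FullSplitComprehension comp public using (_·_; π)
  module T = IxN 𝓣
  module L = IxN 𝓛
  open MonN 𝓛 (SplitSymmetricMonoidalFibration.monoidal 𝓛mon) public
    using (_⊗_; I)

module Submission where

-- For a context Γ, a type A ∈ 𝓣_Γ and linear types Ξ', B ∈ 𝓛_Γ, write p = π_A
-- and Y = [Ξ', B]. The bijection
--   𝓛_{Γ.A}(p*Ξ', p*B) ≅ 𝓛_Γ(LA ⊗ Ξ', B)
-- is a composite of natural bijections of hom-sets:
--   𝓛_{Γ.A}(p*Ξ', p*B) ≅ 𝓛_{Γ.A}(I ⊗ p*Ξ', p*B) ≅ 𝓛_{Γ.A}(I, [p*Ξ', p*B])
--     ≅ 𝓛_{Γ.A}(I, p*Y) ≅ 𝓛_{Γ.A}(L1, p*Y) ≅ 𝓣_{Γ.A}(1, M(p*Y))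
--     ≅ 𝓣_{Γ.A}(1, p*(MY)) ≅ 𝓣_{Γ.A}(p*1, p*(MY)) ≅ 𝓣_Γ(A, MY)
--     ≅ 𝓛_Γ(LA, Y) ≅ 𝓛_Γ(LA ⊗ Ξ', B),
-- using the unitor, currying, preservation of internal homs by p*, the
-- hypothesis L1 ≅ I, the adjunction L ⊣ M, cartesianness of M and the
-- uniqueness of terminal objects. The one non-formal step is
-- 𝓣_{Γ.A}(p*1, p*X) ≅ 𝓣_Γ(A, X): by fullness of the comprehension both sides
-- are maps Γ.A → Γ.X over Γ, because the projection Γ.A.p*1 → Γ.A is an
-- isomorphism.

open import Defs
open import Function.Bundles using (_↔_; mk↔ₛ′)
open import Function.Related.Propositional using (module EquationalReasoning)
open import Relation.Binary.PropositionalEquality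
  using (_≡_; refl; sym; trans; cong; subst; subst-subst-sym; module ≡-Reasoning)
open import Data.Product using (Σ; _,_; proj₁; proj₂)

module HomBijections {o ℓ} (C : Category o ℓ) where
  open Category C
  open ≡-Reasoning

  precompose : ∀ {X X' Z} → Iso C X X' → (X' ⇒ Z) ↔ (X ⇒ Z)
  precompose i = mk↔ₛ′ (_∘ Iso.from i) (_∘ Iso.to i) (cancel (Iso.isoˡ i)) (cancel (Iso.isoʳ i))
    where
      cancel : ∀ {U V W} {u : V ⇒ U} {v : U ⇒ V} → u ∘ v ≡ id → (g : U ⇒ W) → (g ∘ u) ∘ v ≡ g
      cancel {u = u} {v} uv g = begin
        (g ∘ u) ∘ v ≡⟨ assoc ⟩
        g ∘ (u ∘ v) ≡⟨ cong (g ∘_) uv ⟩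
        g ∘ id      ≡⟨ identityʳ ⟩
        g           ∎

  postcompose : ∀ {X Z Z'} → Iso C Z Z' → (X ⇒ Z) ↔ (X ⇒ Z')
  postcompose i = mk↔ₛ′ (Iso.from i ∘_) (Iso.to i ∘_) (cancel (Iso.isoʳ i)) (cancel (Iso.isoˡ i))
    where
      cancel : ∀ {U V W} {u : V ⇒ U} {v : U ⇒ V} → u ∘ v ≡ id → (g : W ⇒ U) → u ∘ (v ∘ g) ≡ g
      cancel {u = u} {v} uv g = begin
        u ∘ (v ∘ g) ≡⟨ sym assoc ⟩
        (u ∘ v) ∘ g ≡⟨ cong (_∘ g) uv ⟩
        id ∘ g      ≡⟨ identityˡ ⟩
        g           ∎

  terminal-iso : ∀ {T T'} → IsTerminal C T → IsTerminal C T' → Iso C T T'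
  terminal-iso t t' = record
    { from = IsTerminal.! t'
    ; to   = IsTerminal.! t
    ; isoˡ = endo-id t
    ; isoʳ = endo-id t'
    }
    where
      endo-id : ∀ {T} (t : IsTerminal C T) {e : T ⇒ T} → e ≡ id
      endo-id t {e} = trans (IsTerminal.!-unique t e) (sym (IsTerminal.!-unique t id))

  isIso⇒Iso : ∀ {X Y} {f : X ⇒ Y} → IsIso C f → Iso C X Y
  isIso⇒Iso {f = f} i = record
    { from = f ; to = IsIso.inv i ; isoˡ = IsIso.isoˡ i ; isoʳ = IsIso.isoʳ i }

  currying : ∀ {M : SymmetricMonoidal C} (cl : Closed M) {X Y Z} →
             (SymmetricMonoidal._⊗₀_ M X Y ⇒ Z) ↔ (X ⇒ Closed.[_,_] cl Y Z)
  currying {M} cl = mk↔ₛ′ curry uncurry (λ g → sym (curry-unique (uncurry g) g refl)) eval-curry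
    where
      open SymmetricMonoidal M
      open Closed cl
      uncurry : ∀ {X Y Z} → X ⇒ [ Y , Z ] → X ⊗₀ Y ⇒ Z
      uncurry g = eval ∘ (g ⊗₁ id)

module _ {o ℓ o₁ ℓ₁ o₂ ℓ₂} {C : Category o ℓ}
         {T : SplitIndexedCategory C o₁ ℓ₁} {S : SplitIndexedCategory C o₂ ℓ₂}
         {Lf : CartesianFunctor T S} {Mf : CartesianFunctor S T}
         (adj : FibredAdjunction Lf Mf) where
  open FibredAdjunction adj

  adjunct : ∀ {Γ} (A : TN.Ob Γ) (X : SN.Ob Γ) →
            TN.Hom Γ A (Functor.F₀ (CartesianFunctor.F Mf Γ) X)
              ↔ SN.Hom Γ (Functor.F₀ (CartesianFunctor.F Lf Γ) A) X
  adjunct {Γ} A X = mk↔ₛ′ transpose untranspose transpose-untranspose untranspose-transpose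
    where
      open Functor (CartesianFunctor.F Lf Γ) renaming (F₁ to L₁; homomorphism to L-hom)
      open Functor (CartesianFunctor.F Mf Γ) renaming (F₁ to M₁; homomorphism to M-hom)
      module 𝓣Γ = Category (SplitIndexedCategory.Fib T Γ)
      module 𝓢Γ = Category (SplitIndexedCategory.Fib S Γ)
      open ≡-Reasoning

      transpose : TN.Hom Γ A _ → SN.Hom Γ _ X
      transpose g = counit X SN.∘v L₁ g

      untranspose : SN.Hom Γ _ X → TN.Hom Γ A _
      untranspose f = M₁ f TN.∘v unit A

      transpose-untranspose : ∀ f → transpose (untranspose f) ≡ f
      transpose-untranspose f = begin
        counit X SN.∘v L₁ (M₁ f TN.∘v unit A)
          ≡⟨ cong (counit X SN.∘v_) L-hom ⟩
        counit X SN.∘v (L₁ (M₁ f) SN.∘v L₁ (unit A))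
          ≡⟨ sym 𝓢Γ.assoc ⟩
        (counit X SN.∘v L₁ (M₁ f)) SN.∘v L₁ (unit A)
          ≡⟨ cong (SN._∘v L₁ (unit A)) (counit-natural f) ⟩
        (f SN.∘v counit _) SN.∘v L₁ (unit A)
          ≡⟨ 𝓢Γ.assoc ⟩
        f SN.∘v (counit _ SN.∘v L₁ (unit A))
          ≡⟨ cong (f SN.∘v_) (zig A) ⟩
        f SN.∘v SN.idv
          ≡⟨ 𝓢Γ.identityʳ ⟩
        f ∎

      untranspose-transpose : ∀ g → untranspose (transpose g) ≡ g
      untranspose-transpose g = begin
        M₁ (counit X SN.∘v L₁ g) TN.∘v unit A
          ≡⟨ cong (TN._∘v unit A) M-hom ⟩
        (M₁ (counit X) TN.∘v M₁ (L₁ g)) TN.∘v unit A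
          ≡⟨ 𝓣Γ.assoc ⟩
        M₁ (counit X) TN.∘v (M₁ (L₁ g) TN.∘v unit A)
          ≡⟨ cong (M₁ (counit X) TN.∘v_) (sym (unit-natural g)) ⟩
        M₁ (counit X) TN.∘v (unit _ TN.∘v g)
          ≡⟨ sym 𝓣Γ.assoc ⟩
        (M₁ (counit X) TN.∘v unit _) TN.∘v g
          ≡⟨ cong (TN._∘v g) (zag X) ⟩
        TN.idv TN.∘v g
          ≡⟨ 𝓣Γ.identityˡ ⟩
        g ∎

module Comprehension {o ℓ o₁ ℓ₁} {C : Category o ℓ} {T : SplitIndexedCategory C o₁ ℓ₁}
                     (comp : FullSplitComprehension C T) where
  open Category C
  open SplitIndexedCategory T
  open IxN T
  open FullSplitComprehension comp
  open ≡-Reasoning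

  q-id-⟪⟫ : ∀ {Γ} {A X : Ob Γ} (h : Hom Γ A (id ^*₀ X)) →
            q id X ∘ ⟪ h ⟫ ≡ ⟪ subst (Hom Γ A) (id-obj X) h ⟫
  q-id-⟪⟫ {Γ} {A} {X} = relabel (id-obj X) (q id X) (q-identity X)
    where
      relabel : ∀ {Y} (e : Y ≡ X) (r : Γ · Y ⇒ Γ · X) →
                subst (λ Z → Γ · Z ⇒ Γ · X) e r ≡ id →
                (h : Hom Γ A Y) → r ∘ ⟪ h ⟫ ≡ ⟪ subst (Hom Γ A) e h ⟫
      relabel refl r r≡id h = trans (cong (_∘ ⟪ h ⟫) r≡id) identityˡ

  ⟪⟫-injective : ∀ {Γ} {A X : Ob Γ} {a b : Hom Γ A X} → ⟪ a ⟫ ≡ ⟪ b ⟫ → a ≡ b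
  ⟪⟫-injective {Γ} {A} {X} {a} {b} ⟪a⟫≡⟪b⟫ = begin
    a               ≡⟨ sym (subst-subst-sym e) ⟩
    subst _ e a₀    ≡⟨ cong (subst (Hom Γ A) e) a₀≡b₀ ⟩
    subst _ e b₀    ≡⟨ subst-subst-sym e ⟩
    b               ∎
    where
      e = id-obj X
      unrelabel : Hom Γ A X → Hom Γ A (id ^*₀ X)
      unrelabel = subst (Hom Γ A) (sym e)
      a₀ = unrelabel a
      b₀ = unrelabel b
      q-unrelabel : ∀ c → q id X ∘ ⟪ unrelabel c ⟫ ≡ ⟪ c ⟫
      q-unrelabel c = trans (q-id-⟪⟫ (unrelabel c)) (cong ⟪_⟫ (subst-subst-sym e))
      a₀≡b₀ : a₀ ≡ b₀
      a₀≡b₀ = faithful id a₀ b₀ (trans (q-unrelabel a) (trans ⟪a⟫≡⟪b⟫ (sym (q-unrelabel b))))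

  ⟪⟫-full : ∀ {Γ} {A X : Ob Γ} (k : Γ · A ⇒ Γ · X) → π X ∘ k ≡ π A →
            Σ (Hom Γ A X) (λ h → ⟪ h ⟫ ≡ k)
  ⟪⟫-full {X = X} k over =
    let (h , q∘h≡k) = full id k (trans over (sym identityˡ))
    in subst (Hom _ _) (id-obj X) h , trans (sym (q-id-⟪⟫ h)) q∘h≡k

  -- With unit types: the projection Γ.A.(π_A)*1 → Γ.A has the section
  -- induced, via the pullback square of (π_A)*1, by ⟪ ! ⟫ : Γ.A → Γ.1,
  -- and this section is a two-sided inverse.
  module UnitOver (hu : HasUnit T) {Γ : Obj} (A : Ob Γ) where
    open HasUnit hu

    p : Γ · A ⇒ Γ
    p = π A

    1ᴬ : Ob (Γ · A)
    1ᴬ = p ^*₀ one Γ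

    private
      module Square = IsPullback (q-pullback p (one Γ))

      ! : Hom Γ A (one Γ)
      ! = IsTerminal.! (one-terminal Γ)

    section : Γ · A ⇒ Γ · A · 1ᴬ
    section = Square.universal ⟪ ! ⟫ id (trans (⟪⟫-over !) (sym identityʳ))

    π∘section : π 1ᴬ ∘ section ≡ id
    π∘section = Square.p₂∘universal _

    -- the cartesian map q p 1 factors through the projection, since the
    -- vertical map classifying ⟪ ! ⟫ ∘ π 1ᴬ lands in the terminal 1ᴬ
    q-through-π : ⟪ ! ⟫ ∘ π 1ᴬ ≡ q p (one Γ)
    q-through-π = begin
      ⟪ ! ⟫ ∘ π 1ᴬ          ≡⟨ sym (proj₂ lift) ⟩
      q p (one Γ) ∘ ⟪ h ⟫   ≡⟨ cong (λ z → q p (one Γ) ∘ ⟪ z ⟫) h≡id ⟩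
      q p (one Γ) ∘ ⟪ idv ⟫ ≡⟨ cong (q p (one Γ) ∘_) ⟪⟫-identity ⟩
      q p (one Γ) ∘ id      ≡⟨ identityʳ ⟩
      q p (one Γ)           ∎
      where
        lift = full p (⟪ ! ⟫ ∘ π 1ᴬ) (trans (sym assoc) (cong (_∘ π 1ᴬ) (⟪⟫-over !)))
        h = proj₁ lift
        h≡id : h ≡ idv
        h≡id = trans (IsTerminal.!-unique (one-preserved p) h)
                     (sym (IsTerminal.!-unique (one-preserved p) idv))

    section∘π : section ∘ π 1ᴬ ≡ id
    section∘π = trans (Square.unique Square.commute (section ∘ π 1ᴬ) on-q on-π)
                      (sym (Square.unique Square.commute id identityʳ identityʳ))
      where
        on-q : q p (one Γ) ∘ (section ∘ π 1ᴬ) ≡ q p (one Γ)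
        on-q = trans (sym assoc) (trans (cong (_∘ π 1ᴬ) (Square.p₁∘universal _)) q-through-π)
        on-π : π 1ᴬ ∘ (section ∘ π 1ᴬ) ≡ π 1ᴬ
        on-π = trans (sym assoc) (trans (cong (_∘ π 1ᴬ) π∘section) identityˡ)

    -- Both correspond to maps
    -- Γ.A → Γ.X over Γ, the left side after precomposing with the section.
    weakening-bijection : (X : Ob Γ) → Hom (Γ · A) 1ᴬ (p ^*₀ X) ↔ Hom Γ A X
    weakening-bijection X = mk↔ₛ′ strengthen weaken strengthen-weaken weaken-strengthen
      where
        module Square-X = IsPullback (q-pullback p X)

        total : Hom (Γ · A) 1ᴬ (p ^*₀ X) → Γ · A ⇒ Γ · X
        total h = (q p X ∘ ⟪ h ⟫) ∘ section

        total-over : ∀ h → π X ∘ total h ≡ π A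
        total-over h = begin
          π X ∘ ((q p X ∘ ⟪ h ⟫) ∘ section) ≡⟨ sym assoc ⟩
          (π X ∘ (q p X ∘ ⟪ h ⟫)) ∘ section ≡⟨ cong (_∘ section) (sym assoc) ⟩
          ((π X ∘ q p X) ∘ ⟪ h ⟫) ∘ section ≡⟨ cong (λ z → (z ∘ ⟪ h ⟫) ∘ section) Square-X.commute ⟩
          ((p ∘ π (p ^*₀ X)) ∘ ⟪ h ⟫) ∘ section ≡⟨ cong (_∘ section) assoc ⟩
          (p ∘ (π (p ^*₀ X) ∘ ⟪ h ⟫)) ∘ section ≡⟨ cong (λ z → (p ∘ z) ∘ section) (⟪⟫-over h) ⟩
          (p ∘ π 1ᴬ) ∘ section              ≡⟨ assoc ⟩
          p ∘ (π 1ᴬ ∘ section)              ≡⟨ cong (p ∘_) π∘section ⟩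
          p ∘ id                            ≡⟨ identityʳ ⟩
          p                                 ∎

        strengthen : Hom (Γ · A) 1ᴬ (p ^*₀ X) → Hom Γ A X
        strengthen h = proj₁ (⟪⟫-full (total h) (total-over h))

        ⟪strengthen⟫ : ∀ h → ⟪ strengthen h ⟫ ≡ total h
        ⟪strengthen⟫ h = proj₂ (⟪⟫-full (total h) (total-over h))

        weakening : (g : Hom Γ A X) →
                    Σ (Hom (Γ · A) 1ᴬ (p ^*₀ X)) (λ h → q p X ∘ ⟪ h ⟫ ≡ ⟪ g ⟫ ∘ π 1ᴬ)
        weakening g = full p (⟪ g ⟫ ∘ π 1ᴬ) (trans (sym assoc) (cong (_∘ π 1ᴬ) (⟪⟫-over g)))

        weaken : Hom Γ A X → Hom (Γ · A) 1ᴬ (p ^*₀ X)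
        weaken g = proj₁ (weakening g)

        strengthen-weaken : ∀ g → strengthen (weaken g) ≡ g
        strengthen-weaken g = ⟪⟫-injective (begin
          ⟪ strengthen (weaken g) ⟫         ≡⟨ ⟪strengthen⟫ (weaken g) ⟩
          (q p X ∘ ⟪ weaken g ⟫) ∘ section  ≡⟨ cong (_∘ section) (proj₂ (weakening g)) ⟩
          (⟪ g ⟫ ∘ π 1ᴬ) ∘ section          ≡⟨ assoc ⟩
          ⟪ g ⟫ ∘ (π 1ᴬ ∘ section)          ≡⟨ cong (⟪ g ⟫ ∘_) π∘section ⟩
          ⟪ g ⟫ ∘ id                        ≡⟨ identityʳ ⟩
          ⟪ g ⟫                             ∎)

        weaken-strengthen : ∀ h → weaken (strengthen h) ≡ h
        weaken-strengthen h = faithful p (weaken (strengthen h)) h (begin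
          q p X ∘ ⟪ weaken (strengthen h) ⟫    ≡⟨ proj₂ (weakening (strengthen h)) ⟩
          ⟪ strengthen h ⟫ ∘ π 1ᴬ              ≡⟨ cong (_∘ π 1ᴬ) (⟪strengthen⟫ h) ⟩
          ((q p X ∘ ⟪ h ⟫) ∘ section) ∘ π 1ᴬ   ≡⟨ assoc ⟩
          (q p X ∘ ⟪ h ⟫) ∘ (section ∘ π 1ᴬ)   ≡⟨ cong ((q p X ∘ ⟪ h ⟫) ∘_) section∘π ⟩
          (q p X ∘ ⟪ h ⟫) ∘ id                 ≡⟨ identityʳ ⟩
          q p X ∘ ⟪ h ⟫                        ∎)

mainTheorem4 : ∀ {o ℓ o₁ ℓ₁ o₂ ℓ₂} (𝓜 : LDTTModel o ℓ o₁ ℓ₁ o₂ ℓ₂)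
                 (withUnit : WithUnit 𝓜) (lolli : SupportsLolliModel 𝓜)
                 (Lf : CartesianFunctor (LDTTModel.𝓣 𝓜) (LDTTModel.𝓛 𝓜))
                 (Mf : CartesianFunctor (LDTTModel.𝓛 𝓜) (LDTTModel.𝓣 𝓜))
                 (adj : FibredAdjunction Lf Mf) →
                 let open ModelN 𝓜 in
                 (∀ Γ → Iso (SplitIndexedCategory.Fib 𝓛 Γ)
                            (Functor.F₀ (CartesianFunctor.F Lf Γ)
                                        (HasUnit.one (WithUnit.hasUnit withUnit) Γ))
                            (I Γ)) →
                 ∀ Γ (A : T.Ob Γ) (Ξ' B : L.Ob Γ) →
                 L.Hom (Γ · A) (π A L.^*₀ Ξ') (π A L.^*₀ B)
                   ↔ L.Hom Γ (Functor.F₀ (CartesianFunctor.F Lf Γ) A ⊗ Ξ') B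
mainTheorem4 𝓜 withUnit lolli Lf Mf adj L1≅I Γ A Ξ' B = begin
  L.Hom Δ (p L.^*₀ Ξ') (p L.^*₀ B)
    ↔⟨ 𝓛Δ.precompose (SymmetricMonoidal.unitorˡ (monoidal Δ) _) ⟩
  L.Hom Δ (I Δ ⊗ p L.^*₀ Ξ') (p L.^*₀ B)
    ↔⟨ 𝓛Δ.currying (closed Δ) ⟩
  L.Hom Δ (I Δ) (Closed.[_,_] (closed Δ) (p L.^*₀ Ξ') (p L.^*₀ B))
    ↔⟨ 𝓛Δ.postcompose (𝓛Δ.isIso⇒Iso (preserves-hom p Ξ' B)) ⟨
  L.Hom Δ (I Δ) (p L.^*₀ Y)
    ↔⟨ 𝓛Δ.precompose (L1≅I Δ) ⟩
  L.Hom Δ (L₀ (one Δ)) (p L.^*₀ Y)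
    ↔⟨ adjunct adj (one Δ) (p L.^*₀ Y) ⟨
  T.Hom Δ (one Δ) (M₀ (p L.^*₀ Y))
    ↔⟨ 𝓣Δ.postcompose (NatIso.η (CartesianFunctor.φ Mf p) Y) ⟨
  T.Hom Δ (one Δ) (p T.^*₀ M₀ Y)
    ↔⟨ 𝓣Δ.precompose (𝓣Δ.terminal-iso (one-preserved p) (one-terminal Δ)) ⟩
  T.Hom Δ (p T.^*₀ one Γ) (p T.^*₀ M₀ Y)
    ↔⟨ UnitOver.weakening-bijection hasUnit A (M₀ Y) ⟩
  T.Hom Γ A (M₀ Y)
    ↔⟨ adjunct adj A Y ⟩
  L.Hom Γ (L₀ A) Y
    ↔⟨ 𝓛Γ.currying (closed Γ) ⟨
  L.Hom Γ (L₀ A ⊗ Ξ') B ∎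
  where
    open ModelN 𝓜
    open EquationalReasoning
    open SplitSymmetricMonoidalFibration 𝓛mon using (monoidal)
    open SupportsLolli lolli
    open WithUnit withUnit
    open HasUnit hasUnit
    open Comprehension comp
    module 𝓛Δ = HomBijections (SplitIndexedCategory.Fib 𝓛 (Γ · A))
    module 𝓛Γ = HomBijections (SplitIndexedCategory.Fib 𝓛 Γ)
    module 𝓣Δ = HomBijections (SplitIndexedCategory.Fib 𝓣 (Γ · A))
    Δ = Γ · A
    p = π A
    L₀ : ∀ {Θ} → T.Ob Θ → L.Ob Θ
    L₀ {Θ} = Functor.F₀ (CartesianFunctor.F Lf Θ)
    M₀ : ∀ {Θ} → L.Ob Θ → T.Ob Θ
    M₀ {Θ} = Functor.F₀ (CartesianFunctor.F Mf Θ)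
    Y = Closed.[_,_] (closed Γ) Ξ' B
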